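{- Let $G$ be an interval graph with vertices $v_1,\ldots,v_n$ and an interval representation $I_G(v_i)=[a_i,b_i]$ with $b_1\le b_2\le\cdots\le b_n$, and let $A_{I_G}$ be the corresponding interval endpoints sequence. Consider the following procedure: start with $S=()$ and a flag set to false; scan $A_{I_G}$ from left to right; when the current element is a left endpoint $a_i$, set the flag to true; when the current element is a right endpoint $b_i$ and the flag is true, append $v_i$ to $S$ and set the flag to false; otherwise do nothing. Then the resulting sequence $S$ is a Grundy dominating sequence of $G$. In addition, for any interval representation $I_G$ of $G$, $\gamma_{gr}(G)$ equals the number of pairs of consecutive entries of $A_{I_G}$ of the form $(a_i,b_j)$ (a left endpoint immediately followed by a right endpoint).
   Context: An interval graph is a graph admitting an interval representation: an assignment of closed real intervals to vertices such that two vertices are adjacent iff their intervals intersect. Given the representation $I_G(v_i)=[a_i,b_i]$, the interval endpoints sequence $A_{I_G}$ is the non-decreasing sequence of length $2n$ listing all the numbers $a_1,b_1,\ldots,a_n,b_n$ (as a multiset), where whenever $a_i=b_j$ the entry $a_i$ is placed before $b_j$; each entry is remembered as being the left endpoint $a_i$ or the right endpoint $b_i$ of a specific vertex. For a vertex $v$, $N[v]$ is its closed neighborhood. A sequence $(x_1,\ldots,x_k)$ of distinct vertices is legal if $N[x_i]\setminus\bigcup_{j<i}N[x_j]\neq\emptyset$ for all $i$, and dominating if moreover $\{x_1,\ldots,x_k\}$ dominates $G$. $\gamma_{gr}(G)$ is the maximum length of a legal dominating sequence; one of that length is a Grundy dominating sequence.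
   Formalization: The interval endpoints $a_i$ and $b_i$ of the representation are rational numbers rather than real numbers. -}

module Defs where

open import Data.Nat using (ℕ; zero; suc)
open import Data.Bool using (Bool; true; false)
open import Data.Fin using (Fin)
open import Data.List using (List; []; _∷_; _++_; length; concatMap; allFin)
open import Data.List.Relation.Unary.All using (All)
open import Data.List.Relation.Unary.Any using (Any)
open import Data.List.Relation.Unary.AllPairs using (AllPairs)
open import Data.List.Relation.Unary.Unique.Propositional using (Unique)
open import Data.List.Relation.Binary.Permutation.Propositional using (_↭_)
open import Data.Rational using (ℚ; _≤_)
open import Data.Product using (Σ; _×_; _,_)
open import Data.Sum using (_⊎_)
open import Data.Unit using (⊤)
open import Data.Empty using (⊥)
open import Relation.Nullary using (¬_)
open import Relation.Binary.PropositionalEquality using (_≡_; _≢_)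
open import Function.Bundles using (_⇔_)

record Graph (n : ℕ) : Set₁ where
  field
    Adj   : Fin n → Fin n → Set
    sym   : ∀ {x y} → Adj x y → Adj y x
    irrefl : ∀ {x} → ¬ Adj x x
open Graph public

module _ {n : ℕ} (G : Graph n) where

  InN : Fin n → Fin n → Set
  InN x w = (w ≡ x) ⊎ Adj G x w

  LegalFrom : List (Fin n) → List (Fin n) → Set
  LegalFrom prev []       = ⊤
  LegalFrom prev (x ∷ xs) =
    (Σ (Fin n) λ w → InN x w × All (λ y → ¬ InN y w) prev)
    × LegalFrom (prev ++ (x ∷ [])) xs

  Legal : List (Fin n) → Set
  Legal xs = Unique xs × LegalFrom [] xs

  Dominating : List (Fin n) → Set
  Dominating xs = ∀ w → Any (λ x → InN x w) xs

  LegalDominating : List (Fin n) → Set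
  LegalDominating xs = Legal xs × Dominating xs

  IsGrundyDomSeq : List (Fin n) → Set
  IsGrundyDomSeq xs =
    LegalDominating xs × (∀ ys → LegalDominating ys → Data.List.length ys Data.Nat.≤ length xs)

  IsGrundyNumber : ℕ → Set
  IsGrundyNumber k =
    (Σ (List (Fin n)) λ xs → LegalDominating xs × length xs ≡ k)
    × (∀ ys → LegalDominating ys → length ys Data.Nat.≤ k)

Intersect : {n : ℕ} → (a b : Fin n → ℚ) → Fin n → Fin n → Set
Intersect a b i j = (a i ≤ b j) × (a j ≤ b i)

IsIntervalRep : {n : ℕ} → Graph n → (a b : Fin n → ℚ) → Set
IsIntervalRep {n} G a b =
  (∀ i → a i ≤ b i) × (∀ i j → i ≢ j → (Adj G i j ⇔ Intersect a b i j))

data End (n : ℕ) : Set where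
  L : Fin n → End n
  R : Fin n → End n

val : {n : ℕ} → (a b : Fin n → ℚ) → End n → ℚ
val a b (L i) = a i
val a b (R i) = b i

allEnds : (n : ℕ) → List (End n)
allEnds n = concatMap (λ i → L i ∷ R i ∷ []) (allFin n)

-- e may come before e' : values non-decreasing, and a right endpoint never
-- precedes a left endpoint of equal value
OrderedPair : {n : ℕ} → (a b : Fin n → ℚ) → End n → End n → Set
OrderedPair a b e       (R j) = val a b e ≤ b j
OrderedPair a b (L i)   (L j) = a i ≤ a j
OrderedPair a b (R i)   (L j) = (b i ≤ a j) × (b i ≢ a j)

IsEndpointSeq : {n : ℕ} → (a b : Fin n → ℚ) → List (End n) → Set
IsEndpointSeq {n} a b A = (A ↭ allEnds n) × AllPairs (OrderedPair a b) A

scan : {n : ℕ} → Bool → List (End n) → List (Fin n)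
scan f     []          = []
scan f     (L i ∷ es)  = scan true es
scan true  (R i ∷ es)  = i ∷ scan false es
scan false (R i ∷ es)  = scan false es

procedure : {n : ℕ} → List (End n) → List (Fin n)
procedure A = scan false A

countLR : {n : ℕ} → List (End n) → ℕ
countLR []                   = 0
countLR (L i ∷ [])           = 0
countLR (L i ∷ R j ∷ es)     = suc (countLR (R j ∷ es))
countLR (L i ∷ L j ∷ es)     = countLR (L j ∷ es)
countLR (R i ∷ es)           = countLR es

-- Call a left endpoint immediately followed by a right endpoint, (aᵢ , bⱼ), an LR pair.
-- If two intervals intersect, the first right endpoint after the later of their left
-- endpoints closes an LR pair lying inside both. Sending each vertex x of a legal
-- sequence, together with a vertex w it newly dominates, to an LR pair inside
-- I(x) ∩ I(w) is injective: a repeated pair would lie inside an earlier I(y) and I(w),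
-- putting w in N[y]. So γ_gr is at most the number of LR pairs. Conversely the
-- procedure outputs the right ends vⱼ of the LR pairs (aᵢ , bⱼ); vᵢ is dominated by vⱼ
-- but by no earlier output, whose right endpoint lies strictly before aᵢ; and the LR
-- pair inside any I(w) makes the output dominating.
module Submission where

open import Defs hiding (sym)
open import Data.Nat using (ℕ)
open import Data.Fin using (Fin)
open import Data.List using (List)
open import Data.Rational using (ℚ; _≤_)
open import Data.Product using (_×_)

open import Data.Nat using (suc) renaming (_≤_ to _≤ℕ_)
open import Data.Nat.Properties using (module ≤-Reasoning)
open import Data.Bool using (false; true)
open import Data.Fin using (_≟_)
open import Data.Fin.Properties using (injective⇒≤)
open import Data.List using ([]; _∷_; _∷ʳ_; length; lookup; map)
open import Data.List.Properties using (length-map)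
open import Data.List.Relation.Unary.All as All using (All; []; _∷_)
open import Data.List.Relation.Unary.All.Properties using (∷ʳ⁺; ∷ʳ⁻)
open import Data.List.Relation.Unary.Any as Any using (here; there)
open import Data.List.Relation.Unary.Any.Properties using (lookup-index; map⁺)
open import Data.List.Relation.Unary.AllPairs using (AllPairs; []; _∷_)
open import Data.List.Relation.Unary.Unique.Propositional using (Unique)
open import Data.List.Relation.Binary.Subset.Propositional using (_⊆_)
open import Data.List.Relation.Binary.Permutation.Propositional using (_↭_; ↭-sym)
open import Data.List.Relation.Binary.Permutation.Propositional.Properties using (∈-resp-↭)
open import Data.List.Membership.Propositional using (_∈_; _∉_; lose)
open import Data.List.Membership.Propositional.Properties using (∈-lookup; ∈-allFin; ∈-concatMap⁺; ∈-++⁺ˡ; ∈-++⁺ʳ)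
open import Data.Rational.Properties using (≤-refl; ≤-trans; ≤-antisym; ≤-total)
open import Data.Product using (_,_; proj₁; proj₂; ∃-syntax; ∃₂)
open import Data.Sum using (inj₁; inj₂)
open import Data.Unit using (tt)
open import Data.Empty using (⊥-elim)
open import Function using (_∘_)
open import Function.Bundles using (Equivalence)
open import Relation.Nullary using (¬_; yes; no)
open import Relation.Binary.PropositionalEquality using (_≡_; _≢_; refl; sym; cong; subst; module ≡-Reasoning)

Unique⇒lookup-injective : ∀ {A : Set} {xs : List A} → Unique xs →
                          ∀ {s t} → lookup xs s ≡ lookup xs t → s ≡ t
Unique⇒lookup-injective (_ ∷ _)         {Fin.zero}  {Fin.zero}  _  = refl
Unique⇒lookup-injective (x∉xs ∷ _)      {Fin.zero}  {Fin.suc t} eq =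
  ⊥-elim (All.lookup x∉xs (∈-lookup t) eq)
Unique⇒lookup-injective (x∉xs ∷ _)      {Fin.suc s} {Fin.zero}  eq =
  ⊥-elim (All.lookup x∉xs (∈-lookup s) (sym eq))
Unique⇒lookup-injective (_ ∷ xs-uniq)   {Fin.suc s} {Fin.suc t} eq =
  cong Fin.suc (Unique⇒lookup-injective xs-uniq eq)

Unique-⊆⇒length≤ : ∀ {A : Set} {xs ys : List A} → Unique xs → xs ⊆ ys → length xs ≤ℕ length ys
Unique-⊆⇒length≤ {xs = xs} {ys} xs-uniq xs⊆ys = injective⇒≤ position-injective
  where
  position : Fin (length xs) → Fin (length ys)
  position s = Any.index (xs⊆ys (∈-lookup s))

  position-injective : ∀ {s t} → position s ≡ position t → s ≡ t
  position-injective {s} {t} eq = Unique⇒lookup-injective xs-uniq (begin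
    lookup xs s                ≡⟨ lookup-index (xs⊆ys (∈-lookup s)) ⟩
    lookup ys (position s)     ≡⟨ cong (lookup ys) eq ⟩
    lookup ys (position t)     ≡⟨ sym (lookup-index (xs⊆ys (∈-lookup t))) ⟩
    lookup xs t                ∎)
    where open ≡-Reasoning

legalFrom⇒unique : ∀ {n} (G : Graph n) {prev} xs → LegalFrom G prev xs → Unique xs × All (_∉ prev) xs
legalFrom⇒unique G [] _ = [] , []
legalFrom⇒unique G {prev} (x ∷ xs) ((_ , w∈N[x] , w-fresh) , rest)
  with xs-uniq , xs∉prev∷ʳx ← legalFrom⇒unique G xs rest
  = All.map (λ y∉prev∷ʳx x≡y → y∉prev∷ʳx (subst (_∈ prev ∷ʳ x) x≡y x∈prev∷ʳx)) xs∉prev∷ʳx ∷ xs-uniq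
  , (λ x∈prev → All.lookup w-fresh x∈prev w∈N[x]) ∷ All.map (_∘ ∈-++⁺ˡ) xs∉prev∷ʳx
  where
  x∈prev∷ʳx : x ∈ prev ∷ʳ x
  x∈prev∷ʳx = ∈-++⁺ʳ prev (here refl)

lrPairs : ∀ {n} → List (End n) → List (Fin n × Fin n)
lrPairs []               = []
lrPairs (L i ∷ [])       = []
lrPairs (L i ∷ R j ∷ es) = (i , j) ∷ lrPairs (R j ∷ es)
lrPairs (L i ∷ L j ∷ es) = lrPairs (L j ∷ es)
lrPairs (R i ∷ es)       = lrPairs es

rightEnds : ∀ {n} → List (End n) → List (Fin n)
rightEnds es = map proj₂ (lrPairs es)

length-lrPairs : ∀ {n} (es : List (End n)) → length (lrPairs es) ≡ countLR es
length-lrPairs []               = refl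
length-lrPairs (L i ∷ [])       = refl
length-lrPairs (L i ∷ R j ∷ es) = cong suc (length-lrPairs (R j ∷ es))
length-lrPairs (L i ∷ L j ∷ es) = length-lrPairs (L j ∷ es)
length-lrPairs (R i ∷ es)       = length-lrPairs es

lrPairs-∷⁺ : ∀ {n} (e : End n) es → lrPairs es ⊆ lrPairs (e ∷ es)
lrPairs-∷⁺ (L i) (R j ∷ es) = there
lrPairs-∷⁺ (L i) (L j ∷ es) p = p
lrPairs-∷⁺ (R i) es         p = p

procedure≡rightEnds : ∀ {n} (es : List (End n)) → procedure es ≡ rightEnds es
procedure≡rightEnds = scan-false
  where
  scan-false : ∀ {n} (es : List (End n)) → scan false es ≡ rightEnds es
  scan-true  : ∀ {n} (i : Fin n) es → scan true es ≡ rightEnds (L i ∷ es)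
  scan-false []         = refl
  scan-false (L i ∷ es) = scan-true i es
  scan-false (R i ∷ es) = scan-false es
  scan-true i []         = refl
  scan-true i (L j ∷ es) = scan-true j es
  scan-true i (R j ∷ es) = cong (j ∷_) (scan-false es)

length-procedure : ∀ {n} (es : List (End n)) → length (procedure es) ≡ countLR es
length-procedure es = begin
  length (procedure es)  ≡⟨ cong length (procedure≡rightEnds es) ⟩
  length (rightEnds es)  ≡⟨ length-map proj₂ (lrPairs es) ⟩
  length (lrPairs es)    ≡⟨ length-lrPairs es ⟩
  countLR es             ∎
  where open ≡-Reasoning

∈-allEnds : ∀ {n} (e : End n) → e ∈ allEnds n
∈-allEnds (L i) = ∈-concatMap⁺ _ (lose (∈-allFin i) (here refl))
∈-allEnds (R i) = ∈-concatMap⁺ _ (lose (∈-allFin i) (there (here refl)))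

↭allEnds⇒complete : ∀ {n} {A : List (End n)} → A ↭ allEnds n → ∀ e → e ∈ A
↭allEnds⇒complete A↭allEnds e = ∈-resp-↭ (↭-sym A↭allEnds) (∈-allEnds e)

R∈L∷⁻ : ∀ {n} {v u : Fin n} {es} → R v ∈ L u ∷ es → R v ∈ es
R∈L∷⁻ (there p) = p

module SortedEndpoints {n : ℕ} (a b : Fin n → ℚ) where

  Sorted : List (End n) → Set
  Sorted = AllPairs (OrderedPair a b)

  Closed : List (End n) → Set
  Closed es = ∀ {v} → L v ∈ es → R v ∈ es

  Inside : Fin n × Fin n → Fin n → Set
  Inside (i , j) v = a v ≤ a i × b j ≤ b v

  Avoids : List (Fin n) → Fin n × Fin n → Set
  Avoids prev c = All (λ y → ¬ Inside c y) prev

  R-before-L⇒≰ : ∀ {y i} → OrderedPair a b (R y) (L i) → ¬ a i ≤ b y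
  R-before-L⇒≰ (y≤i , y≢i) i≤y = y≢i (≤-antisym y≤i i≤y)

  R-after-L : ∀ {e es w x} → Sorted (e ∷ es) → L w ∈ es → a w ≤ b x → R x ∈ e ∷ es → R x ∈ es
  R-after-L (e≤es ∷ _) Lw∈es w≤x (here refl) = ⊥-elim (R-before-L⇒≰ (All.lookup e≤es Lw∈es) w≤x)
  R-after-L _          _     _   (there p)   = p

  R-head-min : ∀ {j es x} → Sorted (R j ∷ es) → R x ∈ R j ∷ es → b j ≤ b x
  R-head-min _          (here refl) = ≤-refl
  R-head-min (j≤es ∷ _) (there p)   = All.lookup j≤es p

  lrPairs-sorted : ∀ {i j} es → Sorted es → (i , j) ∈ lrPairs es → a i ≤ b j
  lrPairs-sorted (L i ∷ R j ∷ es) ((i≤j ∷ _) ∷ _) (here refl) = i≤j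
  lrPairs-sorted (L i ∷ R j ∷ es) (_ ∷ s)         (there p)   = lrPairs-sorted (R j ∷ es) s p
  lrPairs-sorted (L i ∷ L j ∷ es) (_ ∷ s)         p           = lrPairs-sorted (L j ∷ es) s p
  lrPairs-sorted (R i ∷ es)       (_ ∷ s)         p           = lrPairs-sorted es s p

  first-R-after-L : ∀ {u v} es → Sorted (L u ∷ es) → R v ∈ es →
    ∃₂ λ i j → (i , j) ∈ lrPairs (L u ∷ es) × a u ≤ a i × (∀ {x} → R x ∈ es → b j ≤ b x)
  first-R-after-L {u} (R j ∷ es) (_ ∷ s) _ = u , j , here refl , ≤-refl , R-head-min s
  first-R-after-L (L u′ ∷ es) ((u≤u′ ∷ _) ∷ s) Rv∈
    with i , j , p , u′≤i , j-min ← first-R-after-L es s (R∈L∷⁻ Rv∈)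
    = i , j , p , ≤-trans u≤u′ u′≤i , j-min ∘ R∈L∷⁻

  lrPair-after-L : ∀ {w v} es → Sorted es → L w ∈ es → R v ∈ es → a w ≤ b v →
    ∃₂ λ i j → (i , j) ∈ lrPairs es × a w ≤ a i × (∀ {x} → R x ∈ es → a w ≤ b x → b j ≤ b x)
  lrPair-after-L (_ ∷ es) s (here refl) Rv∈ _
    with i , j , p , w≤i , j-min ← first-R-after-L es s (R∈L∷⁻ Rv∈)
    = i , j , p , w≤i , λ Rx∈ _ → j-min (R∈L∷⁻ Rx∈)
  lrPair-after-L (e ∷ es) s@(_ ∷ s′) (there Lw∈) Rv∈ w≤v
    with i , j , p , w≤i , j-min ← lrPair-after-L es s′ Lw∈ (R-after-L s Lw∈ w≤v Rv∈) w≤v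
    = i , j , lrPairs-∷⁺ e es p , w≤i , λ Rx∈ w≤x → j-min (R-after-L s Lw∈ w≤x Rx∈) w≤x

  module _ (a≤b : ∀ i → a i ≤ b i) where

    Closed-tail : ∀ {e es} → Sorted (e ∷ es) → Closed (e ∷ es) → Closed es
    Closed-tail s closed Lv∈ = R-after-L s Lv∈ (a≤b _) (closed (there Lv∈))

    module _ {A : List (End n)} (sorted : Sorted A) (complete : ∀ e → e ∈ A) where

      lrPair-inside-ordered : ∀ {v w} → a v ≤ a w → a w ≤ b v →
        ∃₂ λ i j → (i , j) ∈ lrPairs A × Inside (i , j) v × Inside (i , j) w
      lrPair-inside-ordered {v} {w} v≤w w≤v
        with i , j , p , w≤i , j-min ← lrPair-after-L A sorted (complete (L w)) (complete (R v)) w≤v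
        = i , j , p
        , (≤-trans v≤w w≤i , j-min (complete (R v)) w≤v)
        , (w≤i , j-min (complete (R w)) (a≤b w))

      lrPair-inside : ∀ {v w} → Intersect a b v w →
        ∃₂ λ i j → (i , j) ∈ lrPairs A × Inside (i , j) v × Inside (i , j) w
      lrPair-inside {v} {w} (v≤w , w≤v) with ≤-total (a v) (a w)
      ... | inj₁ av≤aw = lrPair-inside-ordered av≤aw w≤v
      ... | inj₂ aw≤av with i , j , p , in-w , in-v ← lrPair-inside-ordered aw≤av v≤w
        = i , j , p , in-v , in-w

module _ {n : ℕ} {G : Graph n} {a b : Fin n → ℚ} (rep : IsIntervalRep G a b) where

  open SortedEndpoints a b

  a≤b : ∀ i → a i ≤ b i
  a≤b = proj₁ rep

  intersect⇒InN : ∀ {x w} → Intersect a b x w → InN G x w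
  intersect⇒InN {x} {w} xw with w ≟ x
  ... | yes w≡x = inj₁ w≡x
  ... | no  w≢x = inj₂ (Equivalence.from (proj₂ rep x w (w≢x ∘ sym)) xw)

  InN⇒intersect : ∀ {x w} → InN G x w → Intersect a b x w
  InN⇒intersect {x} (inj₁ refl) = a≤b x , a≤b x
  InN⇒intersect {x} {w} (inj₂ x∼w) = Equivalence.to (proj₂ rep x w x≢w) x∼w
    where
    x≢w : x ≢ w
    x≢w refl = irrefl G x∼w

  inside-both⇒InN : ∀ {i j y w} → a i ≤ b j → Inside (i , j) y → Inside (i , j) w → InN G y w
  inside-both⇒InN i≤j (y≤i , j≤y) (w≤i , j≤w) =
    intersect⇒InN (≤-trans y≤i (≤-trans i≤j j≤w) , ≤-trans w≤i (≤-trans i≤j j≤y))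

  R-before-L⇒¬InN : ∀ {y i} → OrderedPair a b (R y) (L i) → ¬ InN G y i
  R-before-L⇒¬InN y<i = R-before-L⇒≰ y<i ∘ proj₂ ∘ InN⇒intersect

  rightEnds-legalFrom : ∀ {prev} es → Sorted es → Closed es →
    All (λ y → All (OrderedPair a b (R y)) es) prev → LegalFrom G prev (rightEnds es)
  rightEnds-legalFrom []               _ _ _ = tt
  rightEnds-legalFrom (L i ∷ [])       _ _ _ = tt
  rightEnds-legalFrom (L i ∷ R j ∷ es) s@((i≤j ∷ _) ∷ sRj@(j≤es ∷ ses)) closed prev≤ =
    (i , i∈N[j] , All.map (R-before-L⇒¬InN ∘ All.head) prev≤)
    , rightEnds-legalFrom es ses (Closed-tail a≤b sRj (Closed-tail a≤b s closed))
        (∷ʳ⁺ (All.map (All.tail ∘ All.tail) prev≤) j≤es)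
    where
    i∈N[j] : InN G j i
    i∈N[j] = intersect⇒InN (≤-trans (a≤b j) (R-head-min sRj (R∈L∷⁻ (closed (here refl)))) , i≤j)
  rightEnds-legalFrom (L i ∷ L j ∷ es) s@(_ ∷ s′) closed prev≤ =
    rightEnds-legalFrom (L j ∷ es) s′ (Closed-tail a≤b s closed) (All.map All.tail prev≤)
  rightEnds-legalFrom (R i ∷ es)       s@(_ ∷ s′) closed prev≤ =
    rightEnds-legalFrom es s′ (Closed-tail a≤b s closed) (All.map All.tail prev≤)

  module _ {A : List (End n)} (sorted : Sorted A) (complete : ∀ e → e ∈ A) where

    rightEnds-dominating : Dominating G (rightEnds A)
    rightEnds-dominating w
      with i , j , p , (w≤i , j≤w) , _ ← lrPair-inside a≤b sorted complete (a≤b w , a≤b w)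
      = map⁺ (lose p (intersect⇒InN (≤-trans (a≤b j) j≤w , ≤-trans w≤i (lrPairs-sorted A sorted p))))

    rightEnds-legalDominating : LegalDominating G (rightEnds A)
    rightEnds-legalDominating = (proj₁ (legalFrom⇒unique G _ legal) , legal) , rightEnds-dominating
      where
      legal : LegalFrom G [] (rightEnds A)
      legal = rightEnds-legalFrom A sorted (λ {v} _ → complete (R v)) []

    legalFrom⇒distinct-lrPairs : ∀ {prev} xs → LegalFrom G prev xs →
      ∃[ cs ] length cs ≡ length xs × Unique cs × cs ⊆ lrPairs A × All (Avoids prev) cs
    legalFrom⇒distinct-lrPairs [] _ = [] , refl , [] , (λ ()) , []
    legalFrom⇒distinct-lrPairs {prev} (x ∷ xs) ((_ , w∈N[x] , w-fresh) , rest)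
      with i , j , p , in-x , in-w ← lrPair-inside a≤b sorted complete (InN⇒intersect w∈N[x])
         | cs , len , cs-uniq , cs⊆ , cs-avoid ← legalFrom⇒distinct-lrPairs xs rest
      = (i , j) ∷ cs , cong suc len , ij∉cs ∷ cs-uniq
      , (λ { (here refl) → p ; (there q) → cs⊆ q })
      , ij-avoids ∷ All.map (proj₁ ∘ ∷ʳ⁻) cs-avoid
      where
      ij∉cs : All ((i , j) ≢_) cs
      ij∉cs = All.map (λ c-avoids ij≡c → proj₂ (∷ʳ⁻ c-avoids) (subst (λ c → Inside c x) ij≡c in-x)) cs-avoid

      ij-avoids : Avoids prev (i , j)
      ij-avoids = All.map (λ ¬y∼w in-y → ¬y∼w (inside-both⇒InN (lrPairs-sorted A sorted p) in-y in-w)) w-fresh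

    legalDominating⇒length≤ : ∀ ys → LegalDominating G ys → length ys ≤ℕ countLR A
    legalDominating⇒length≤ ys ((_ , legal) , _)
      with cs , len , cs-uniq , cs⊆ , _ ← legalFrom⇒distinct-lrPairs ys legal
      = begin
        length ys           ≡⟨ sym len ⟩
        length cs           ≤⟨ Unique-⊆⇒length≤ cs-uniq cs⊆ ⟩
        length (lrPairs A)  ≡⟨ length-lrPairs A ⟩
        countLR A           ∎
      where open ≤-Reasoning

theorem4p1 : (n : ℕ) (G : Graph n) (a b : Fin n → ℚ) → IsIntervalRep G a b →
    (A : List (End n)) → IsEndpointSeq a b A →
    ((∀ (i j : Fin n) → i Data.Fin.≤ j → b i ≤ b j) → IsGrundyDomSeq G (procedure A))
    × IsGrundyNumber G (countLR A)
theorem4p1 n G a b rep A (A↭allEnds , sorted) =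
  (λ _ → procedure-legalDominating
       , λ ys → subst (length ys ≤ℕ_) (sym (length-procedure A)) ∘ bound ys)
  , (procedure A , procedure-legalDominating , length-procedure A) , bound
  where
  complete : ∀ e → e ∈ A
  complete = ↭allEnds⇒complete A↭allEnds

  procedure-legalDominating : LegalDominating G (procedure A)
  procedure-legalDominating =
    subst (LegalDominating G) (sym (procedure≡rightEnds A)) (rightEnds-legalDominating rep sorted complete)

  bound : ∀ ys → LegalDominating G ys → length ys ≤ℕ countLR A
  bound = legalDominating⇒length≤ rep sorted complete
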